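{- If $I$ is a normal Riesz $\gamma$-ideal in the GPEA $P$, then $I$ is a normal Riesz ideal in the $\gamma$-unitization $U$ of $P$ iff $\sim_I$ satisfies the (GCR) condition on $P$.
   Context: $P$ is a GPEA (partial $\oplus$, constant $0$; partial associativity; conjugation; two-sided cancellation; neutral $0$; positivity), ordered by $a\le b$ iff $a\oplus c=b$ for some $c$; for $a\le b$, $a/b$ is the unique $c$ with $a\oplus c=b$ and $b\backslash a$ the unique $d$ with $d\oplus a=b$. $\gamma$ is a unitizing GPEA-automorphism ($\gamma a\oplus b$ defined iff $b\oplus a$ defined). The $\gamma$-unitization $U=P\cup P^\eta$ ($\eta$ a bijection onto a disjoint set, $1:=\eta0$): sums in $P$ as in $P$; $a+\eta b$ defined iff $a\le b$, equal to $\eta(b\backslash a)$; $\eta a+b$ defined iff $\gamma b\le a$, equal to $\eta(\gamma b/a)$; no sums within $P^\eta$; $U$ is a pseudo effect algebra. Ideal: nonempty down-set closed under existing sums; normal: $a\oplus c=c\oplus b$ implies ($a\in I\Leftrightarrow b\in I$); $\gamma$-ideal: $a\in I\Leftrightarrow\gamma a\in I$. Riesz ideal: (R1) if $i\in I$, $i\le a\oplus b$ then $i\le j\oplus k$ for some $j,k\in I$, $j\le a$, $k\le b$; (R2) if $i\in I$, $i\le a$: (i) if $(a\backslash i)\oplus b$ exists there is $j\in I$, $j\le b$, with $a\oplus(j/b)$ existing; (ii) if $b\oplus(i/a)$ exists there is $k\in I$, $k\le b$, with $(b\backslash k)\oplus a$ existing. $a\sim_I b$ iff $a\backslash i=b\backslash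 j$ for some $i,j\in I$, $i\le a$, $j\le b$. (GCR): $a\sim_I b$ implies there exist $i,j\in I$ with $i\oplus a=j\oplus b$ (equivalently $k,\ell\in I$ with $a\oplus k=b\oplus\ell$). -}

module Defs where

open import Data.Product using (Σ; Σ-syntax; _×_; _,_)
open import Data.Sum using (_⊎_; inj₁; inj₂)
open import Data.Empty using (⊥)
open import Relation.Binary.PropositionalEquality using (_≡_)

_⟺_ : Set → Set → Set
A ⟺ B = (A → B) × (B → A)

-- Generic notions for a partial algebra given by its sum relation
-- S a b c  means  "a ⊕ b is defined and equals c".
module PartialAlg {A : Set} (S : A → A → A → Set) where

  Defined : A → A → Set
  Defined a b = Σ[ c ∈ A ] S a b c

  _≤_ : A → A → Set
  a ≤ b = Σ[ c ∈ A ] S a c b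

  IsIdeal : (A → Set) → Set
  IsIdeal I =
      (Σ[ a ∈ A ] I a)
    × (∀ {a b} → a ≤ b → I b → I a)
    × (∀ {a b c} → S a b c → I a → I b → I c)

  IsNormal : (A → Set) → Set
  IsNormal I = ∀ {a b c d} → S a c d → S c b d → (I a ⟺ I b)

  R1 : (A → Set) → Set
  R1 I = ∀ {i a b s} → I i → S a b s → i ≤ s →
         Σ[ j ∈ A ] Σ[ k ∈ A ] I j × I k × j ≤ a × k ≤ b ×
           (Σ[ t ∈ A ] S j k t × i ≤ t)

  -- (R2)(i): i ∈ I, i ≤ a, (a\i) ⊕ b exists (a\i = d with d ⊕ i = a)
  --   ⇒ ∃ j ∈ I, j ≤ b, with a ⊕ (j/b) existing (j/b = c with j ⊕ c = b)
  R2i : (A → Set) → Set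
  R2i I = ∀ {i a b d} → I i → i ≤ a → S d i a → Defined d b →
          Σ[ j ∈ A ] I j × j ≤ b × (Σ[ c ∈ A ] S j c b × Defined a c)

  -- (R2)(ii): i ∈ I, i ≤ a, b ⊕ (i/a) exists (i/a = c with i ⊕ c = a)
  --   ⇒ ∃ k ∈ I, k ≤ b, with (b\k) ⊕ a existing (b\k = d with d ⊕ k = b)
  R2ii : (A → Set) → Set
  R2ii I = ∀ {i a b c} → I i → i ≤ a → S i c a → Defined b c →
           Σ[ k ∈ A ] I k × k ≤ b × (Σ[ d ∈ A ] S d k b × Defined d a)

  IsRieszIdeal : (A → Set) → Set
  IsRieszIdeal I = IsIdeal I × R1 I × R2i I × R2ii I

  IsNormalRieszIdeal : (A → Set) → Set
  IsNormalRieszIdeal I = IsRieszIdeal I × IsNormal I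

  Sim : (A → Set) → A → A → Set
  Sim I a b = Σ[ i ∈ A ] Σ[ j ∈ A ] I i × I j × i ≤ a × j ≤ b ×
              (Σ[ d ∈ A ] S d i a × S d j b)

  GCR : (A → Set) → Set
  GCR I = ∀ {a b} → Sim I a b →
          Σ[ i ∈ A ] Σ[ j ∈ A ] I i × I j × (Σ[ c ∈ A ] S i a c × S j b c)

record GPEA : Set₁ where
  field
    Carrier : Set
    S       : Carrier → Carrier → Carrier → Set
    𝟘       : Carrier
    functional : ∀ {a b c c'} → S a b c → S a b c' → c ≡ c'
    assoc₁ : ∀ {a b c d e} → S a b d → S d c e → Σ[ f ∈ Carrier ] S b c f × S a f e
    assoc₂ : ∀ {a b c f e} → S b c f → S a f e → Σ[ d ∈ Carrier ] S a b d × S d c e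
    conj : ∀ {a b c} → S a b c → (Σ[ d ∈ Carrier ] S d a c) × (Σ[ e ∈ Carrier ] S b e c)
    cancelˡ : ∀ {a b c d} → S a b d → S a c d → b ≡ c
    cancelʳ : ∀ {a b c d} → S b a d → S c a d → b ≡ c
    neutralʳ : ∀ a → S a 𝟘 a
    neutralˡ : ∀ a → S 𝟘 a a
    positive : ∀ {a b} → S a b 𝟘 → (a ≡ 𝟘) × (b ≡ 𝟘)

  open PartialAlg S public

record UnitizingAut (P : GPEA) : Set where
  open GPEA P
  field
    γ   : Carrier → Carrier
    γ⁻¹ : Carrier → Carrier
    γ-inv₁ : ∀ a → γ (γ⁻¹ a) ≡ a
    γ-inv₂ : ∀ a → γ⁻¹ (γ a) ≡ a
    γ-hom  : ∀ {a b c} → S a b c ⟺ S (γ a) (γ b) (γ c)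
    unitizing : ∀ {a b} → Defined (γ a) b ⟺ Defined b a

-- The γ-unitization U = P ∪ P^η  (inj₁ a = a ∈ P, inj₂ a = η a)

module Unitization (P : GPEA) (u : UnitizingAut P) where
  open GPEA P
  open UnitizingAut u

  U : Set
  U = Carrier ⊎ Carrier

  SU : U → U → U → Set
  SU (inj₁ a) (inj₁ b) (inj₁ c) = S a b c
  -- a + η b defined iff a ≤ b, equal to η (b \ a), where (b\a) ⊕ a = b
  SU (inj₁ a) (inj₂ b) (inj₂ d) = S d a b
  -- η a + b defined iff γ b ≤ a, equal to η (γ b / a), where γ b ⊕ c = a
  SU (inj₂ a) (inj₁ b) (inj₂ c) = S (γ b) c a
  SU _ _ _ = ⊥

  module UAlg = PartialAlg SU

  lift : (Carrier → Set) → U → Set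
  lift I (inj₁ a) = I a
  lift I (inj₂ _) = ⊥

  IsγIdeal : (Carrier → Set) → Set
  IsγIdeal I = ∀ a → I a ⟺ I (γ a)

-- I contains nothing from P^η, so normality and the ideal property pass to U
-- directly (lift-normal, lift-ideal), while each Riesz axiom in U splits into
-- cases according to which elements lie in P^η.  Rewritten in P through the
-- definition of the sum of U, every case is one of
--   * the axiom itself in P;
--   * a Riesz decomposition below a sum with a summand in I, which needs only
--     (R1) (split-left-summand, split-right-summand);
--   * a mixed case (r1-mixed, r1-mixed-γ, r2i-mixed, r2ii-mixed): there one
--     writes two elements as g ⊕ i and g ⊕ j with i, j ∈ I and applies (GCR)
--     (gcr-common-part); enlarge-above is the step shared by both cases of (R1).
-- Conversely (gcr-from-mixed-r2i), (R2)(i) in U for i ≤ a and d + η b, where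
-- a = d ⊕ i and b = d ⊕ j, yields the (GCR) witness for a ∼_I b.

module Submission where

open import Defs
open import Data.Product using (_×_; Σ-syntax; _,_; proj₁; proj₂)
open import Data.Sum using (inj₁; inj₂)
open import Relation.Binary.PropositionalEquality using (refl; sym; subst)

module GPEAFacts (P : GPEA) where
  open GPEA P

  right-summand-≤ : ∀ {a b c} → S a b c → b ≤ c
  right-summand-≤ s = proj₂ (conj s)

  regroup : ∀ {x y z yz} → S y z yz → Defined x yz →
            Σ[ xy ∈ Carrier ] S x y xy × Defined xy z
  regroup syz (e , sx-yz) with assoc₂ syz sx-yz
  ... | (xy , sxy , sxy-z) = xy , sxy , (e , sxy-z)

  defined-left-part : ∀ {a b r c} → Defined a c → S b r c → Defined a b
  defined-left-part a⊕c sbrc with regroup sbrc a⊕c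
  ... | (ab , sab , _) = ab , sab

  defined-right-part : ∀ {a b r c} → Defined a c → S r b c → Defined a b
  defined-right-part a⊕c srbc = defined-left-part a⊕c (proj₂ (right-summand-≤ srbc))

  module _ {I : Carrier → Set} (normal : IsNormal I) where

    move-right : ∀ {x a c} → S x a c → I x → Σ[ x' ∈ Carrier ] S a x' c × I x'
    move-right sxac x∈I with proj₂ (conj sxac)
    ... | (x' , sax'c) = x' , sax'c , proj₁ (normal sxac sax'c) x∈I

    move-left : ∀ {x a c} → S a x c → I x → Σ[ x' ∈ Carrier ] S x' a c × I x'
    move-left saxc x∈I with proj₁ (conj saxc)
    ... | (x' , sx'ac) = x' , sx'ac , proj₂ (normal sx'ac saxc) x∈I

  split-left-summand : ∀ {I : Carrier → Set} → R1 I →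
    ∀ {x a d y c} → I x → S x a d → S y c d →
    Σ[ J ∈ Carrier ] Σ[ C ∈ Carrier ] I J × S J C y × C ≤ a
  split-left-summand r1 {a = a} x∈I sxad sycd with proj₁ (conj sycd)
  ... | (c₁ , sc₁yd) with r1 x∈I sc₁yd (a , sxad)
  -- (R1): x ≤ t = k ⊕ J with k ≤ c₁ and J ≤ y, say y = J ⊕ C; then
  -- d = n ⊕ C with n = c₁ ⊕ J = k ⊕ (c₁' ⊕ J) = k ⊕ (J ⊕ w) = t ⊕ w
  ... | (k , J , _ , J∈I , (c₁' , skc₁'c₁) , (C , sJCy) , (t , skJt , (r , sxrt)))
      with assoc₂ sJCy sc₁yd
  ... | (n , sc₁Jn , snCd) with assoc₁ skc₁'c₁ sc₁Jn
  ... | (m , sc₁'Jm , skmn) with right-summand-≤ sc₁'Jm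
  ... | (w , sJwm) with assoc₂ sJwm skmn
  ... | (t' , skJt' , st'wn) with functional skJt' skJt
  -- n = x ⊕ (r ⊕ w), so d = x ⊕ (q ⊕ C) and cancelling x gives a = q ⊕ C
  ... | refl with assoc₁ sxrt st'wn
  ... | (q , _ , sxqn) with assoc₁ sxqn snCd
  ... | (z , sqCz , sxzd) with cancelˡ sxad sxzd
  ... | refl = J , C , J∈I , sJCy , right-summand-≤ sqCz

  split-right-summand : ∀ {I : Carrier → Set} → IsNormal I → R1 I →
    ∀ {x a d y c} → I x → S a x d → S c y d →
    Σ[ J ∈ Carrier ] Σ[ C ∈ Carrier ] I J × S C J y × (Σ[ z ∈ Carrier ] S z C a)
  split-right-summand normal r1 x∈I saxd scyd with move-left normal saxd x∈I
  ... | (x' , sx'ad , x'∈I) with split-left-summand r1 x'∈I sx'ad (proj₂ (right-summand-≤ scyd))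
  ... | (J , C , J∈I , sJCy , (Y , sCYa)) with move-right normal sJCy J∈I
  ... | (J' , sCJ'y , J'∈I) = J' , C , J'∈I , sCJ'y , proj₁ (conj sCYa)

  gcr-common-part : ∀ {I : Carrier → Set} → GCR I →
    ∀ {g i j a b} → I i → I j → S g i a → S g j b →
    Σ[ p ∈ Carrier ] Σ[ q ∈ Carrier ] I p × I q × (Σ[ c ∈ Carrier ] S p a c × S q b c)
  gcr-common-part gcr {g} {i} {j} i∈I j∈I sgia sgjb =
    gcr (i , j , i∈I , j∈I , right-summand-≤ sgia , right-summand-≤ sgjb , g , sgia , sgjb)

  -- The lemmas below hold for a normal subset satisfying (GCR) and the
  -- indicated Riesz axioms; they are the mixed cases of the axioms in U.
  module _ {I : Carrier → Set} (normal : IsNormal I) (gcr : GCR I) where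

    enlarge-above : R2i I → ∀ {s i c a b} → I i → S s i c → S s a b →
      Σ[ k ∈ Carrier ] Σ[ ak ∈ Carrier ] I k × S a k ak × Defined s ak × i ≤ ak
    -- (R2)(i) for i ≤ c, c \ i = s: a = j ⊕ c₂ with j ∈ I and c ⊕ c₂ = M
    enlarge-above r2i i∈I ssic ssab with r2i i∈I (right-summand-≤ ssic) ssic (_ , ssab)
    ... | (j , j∈I , _ , (c₂ , sjc₂a , (M , scc₂M))) with move-right normal sjc₂a j∈I
    -- b = s ⊕ (c₂ ⊕ j') = g ⊕ j'
    ... | (j' , sc₂j'a , j'∈I) with assoc₂ sc₂j'a ssab
    ... | (g , ssc₂g , sgj'b) with assoc₁ ssic scc₂M
    -- M = s ⊕ h with h = i ⊕ c₂ = c₂ ⊕ i', so M = g ⊕ i'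
    ... | (h , sic₂h , sshM) with move-right normal sic₂h i∈I
    ... | (i' , sc₂i'h , i'∈I) with assoc₂ sc₂i'h sshM
    ... | (g' , ssc₂g' , sg'i'M) with functional ssc₂g' ssc₂g
    -- (GCR): p ⊕ M = q ⊕ b = N, hence M ⊕ k' = b ⊕ k = N with k ∈ I
    ... | refl with gcr-common-part gcr i'∈I j'∈I sg'i'M sgj'b
    ... | (p , q , _ , q∈I , (N , spMN , sqbN)) with move-right normal sqbN q∈I
    ... | (k , sbkN , k∈I) with right-summand-≤ spMN
    -- s ⊕ (a ⊕ k) = N = s ⊕ (h ⊕ k'), so a ⊕ k = h ⊕ k' = i ⊕ (c₂ ⊕ k')
    ... | (k' , sMk'N) with assoc₁ ssab sbkN | assoc₁ sshM sMk'N
    ... | (ak , sakak , ssakN) | (hk' , shk'hk' , sshk'N) with cancelˡ ssakN sshk'N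
    ... | refl with assoc₁ sic₂h shk'hk'
    ... | (v , _ , siv-ak) = k , ak , k∈I , sakak , (N , ssakN) , (v , siv-ak)

    -- (R1) in U for i ≤ a + η b = η s, i.e. s ⊕ i defined and s ⊕ a = b:
    -- i ≤ j ⊕ k with j ≤ a, k ∈ I and b ⊕ k defined.
    r1-mixed : R1 I → R2i I → ∀ {i s c a b} → I i → S s i c → S s a b →
      Σ[ j ∈ Carrier ] Σ[ k ∈ Carrier ] I j × I k × j ≤ a × Defined b k ×
        (Σ[ t ∈ Carrier ] S j k t × i ≤ t)
    r1-mixed r1 r2i i∈I ssic ssab with enlarge-above r2i i∈I ssic ssab
    ... | (k₂ , ak , _ , sak₂ak , s⊕ak , i≤ak) with r1 i∈I sak₂ak i≤ak
    ... | (j , k , j∈I , k∈I , j≤a , (r , skrk₂) , i≤j⊕k) with regroup sak₂ak s⊕ak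
    ... | (b' , ssab' , b'⊕k₂) with functional ssab' ssab
    ... | refl = j , k , j∈I , k∈I , j≤a , defined-left-part b'⊕k₂ skrk₂ , i≤j⊕k

    -- (R2)(i) in U for i ≤ A, A \ i = D and D + η b = η e (e ⊕ D = b):
    -- some j ∈ I has b ⊕ j = x ⊕ A.
    r2i-mixed : R2ii I → ∀ {i D A e b} → I i → S D i A → S e D b →
      Σ[ j ∈ Carrier ] Σ[ M ∈ Carrier ] I j × S b j M × (Σ[ x ∈ Carrier ] S x A M)
    r2i-mixed r2ii i∈I sDiA seDb with move-left normal sDiA i∈I
    -- (R2)(ii) for D' ≤ A, D' / A = D: e = f ⊕ k with k ∈ I and f ⊕ A = N
    ... | (D' , sD'DA , D'∈I) with r2ii D'∈I (_ , sD'DA) sD'DA (_ , seDb)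
    ... | (k , k∈I , _ , (f , sfke , (N , sfAN))) with assoc₁ sfke seDb
    -- b = f ⊕ (k ⊕ D) = f ⊕ (D ⊕ k') = g ⊕ k', and N = f ⊕ (D ⊕ i) = g ⊕ i
    ... | (h , skDh , sfhb) with move-right normal skDh k∈I
    ... | (k' , sDk'h , k'∈I) with assoc₂ sDk'h sfhb
    ... | (g , sfDg , sgk'b) with assoc₂ sDiA sfAN
    ... | (g' , sfDg' , sg'iN) with functional sfDg' sfDg
    -- (GCR): p ⊕ N = q ⊕ b = M, and p ⊕ (f ⊕ A) = (p ⊕ f) ⊕ A
    ... | refl with gcr-common-part gcr i∈I k'∈I sg'iN sgk'b
    ... | (p , q , _ , q∈I , (M , spNM , sqbM)) with move-right normal sqbM q∈I
    ... | (j , sbjM , j∈I) with assoc₂ sfAN spNM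
    ... | (x , _ , sxAM) = j , M , j∈I , sbjM , (x , sxAM)

    -- The mirror of r2i-mixed, used for (R2)(ii) in U: if i ⊕ C = A and
    -- C ⊕ e = b with i ∈ I, then some q ∈ I has q ⊕ b = A ⊕ y.
    r2ii-mixed : R2i I → ∀ {i C A e b} → I i → S i C A → S C e b →
      Σ[ q ∈ Carrier ] Σ[ N ∈ Carrier ] I q × S q b N × (Σ[ y ∈ Carrier ] S A y N)
    r2ii-mixed r2i i∈I siCA sCeb with move-right normal siCA i∈I
    -- (R2)(i) for x ≤ A, A \ x = C: e = j ⊕ c with j ∈ I and A ⊕ c = M
    ... | (x , sCxA , x∈I) with r2i x∈I (right-summand-≤ sCxA) sCxA (_ , sCeb)
    ... | (j , j∈I , _ , (c , sjce , (M , sAcM))) with assoc₁ sCxA sAcM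
    -- M = C ⊕ (x ⊕ c) = C ⊕ (c ⊕ x') = g ⊕ x', and b = C ⊕ (c ⊕ j') = g ⊕ j'
    ... | (h , sxch , sChM) with move-right normal sxch x∈I
    ... | (x' , scx'h , x'∈I) with assoc₂ scx'h sChM
    ... | (g , sCcg , sgx'M) with move-right normal sjce j∈I
    ... | (j' , scj'e , j'∈I) with assoc₂ scj'e sCeb
    ... | (g' , sCcg' , sg'j'b) with functional sCcg' sCcg
    -- (GCR): p ⊕ M = q ⊕ b = N, and p ⊕ (A ⊕ c) = (A ⊕ p') ⊕ c
    ... | refl with gcr-common-part gcr x'∈I j'∈I sgx'M sg'j'b
    ... | (p , q , _ , q∈I , (N , spMN , sqbN)) with assoc₂ sAcM spMN
    ... | (pA , spApA , spA-cN) with right-summand-≤ spApA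
    ... | (p' , sAp'pA) with assoc₁ sAp'pA spA-cN
    ... | (y , _ , sAyN) = q , N , q∈I , sqbN , (y , sAyN)

  left-summand-in-I : ∀ {I : Carrier → Set} → IsNormal I → IsIdeal I →
    ∀ {x a b w N d i j} → I w → I j → S x a N → S w b N → S d i a → S d j b → I x
  left-summand-in-I normal (_ , down , closed) w∈I j∈I sxaN swbN sdia sdjb
    with proj₁ (conj sdia) | move-left normal sdjb j∈I
  -- N = (x ⊕ i') ⊕ d = (w ⊕ j') ⊕ d, so x ≤ x ⊕ i' = w ⊕ j' ∈ I
  ... | (i' , si'da) | (j' , sj'db , j'∈I) with assoc₂ si'da sxaN | assoc₂ sj'db swbN
  ... | (_ , sxi'm , smdN) | (_ , swj'n , sndN) with cancelʳ smdN sndN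
  ... | refl = down (_ , sxi'm) (closed swj'n w∈I j'∈I)

module UnitizationFacts (P : GPEA) (u : UnitizingAut P) where
  open GPEA P
  open UnitizingAut u
  open Unitization P u
  open GPEAFacts P

  γ⁻¹-preserves : ∀ {I : Carrier → Set} → IsγIdeal I → ∀ {J} → I J → I (γ⁻¹ J)
  γ⁻¹-preserves {I} γ-ideal {J} J∈I =
    proj₂ (γ-ideal (γ⁻¹ J)) (subst I (sym (γ-inv₁ J)) J∈I)

  γ⁻¹-sum : ∀ {J C b} → S J C (γ b) → S (γ⁻¹ J) (γ⁻¹ C) b
  γ⁻¹-sum {J} {C} {b} sJC = proj₂ γ-hom
    (subst (λ v → S v (γ (γ⁻¹ C)) (γ b)) (sym (γ-inv₁ J))
      (subst (λ v → S J v (γ b)) (sym (γ-inv₁ C)) sJC))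

  ≤-P : ∀ {a b} → a ≤ b → UAlg._≤_ (inj₁ a) (inj₁ b)
  ≤-P (c , sacb) = inj₁ c , sacb

  ≤-η : ∀ {a b} → Defined b a → UAlg._≤_ (inj₁ a) (inj₂ b)
  ≤-η (c , sbac) = inj₂ c , sbac

  below-sum-P : ∀ {i j k} → Σ[ t ∈ Carrier ] S j k t × i ≤ t →
    Σ[ t ∈ U ] SU (inj₁ j) (inj₁ k) t × UAlg._≤_ (inj₁ i) t
  below-sum-P (t , sjkt , i≤t) = inj₁ t , sjkt , ≤-P i≤t

  -- Normality of the lifted subset uses only normality of I and γ-invariance;
  -- the only case not inherited from P is a + η c = η d = η c + b, where
  -- γ b ⊕ d = c = d ⊕ a.
  lift-normal : ∀ {I : Carrier → Set} → IsNormal I → IsγIdeal I → UAlg.IsNormal (lift I)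
  lift-normal normal γ-ideal {inj₁ a} {inj₁ b} {inj₁ c} {inj₁ d} p q = normal p q
  lift-normal normal γ-ideal {inj₁ a} {inj₁ b} {inj₂ c} {inj₂ d} p q =
    (λ a∈I → proj₂ (γ-ideal b) (proj₂ (normal q p) a∈I)) ,
    (λ b∈I → proj₁ (normal q p) (proj₁ (γ-ideal b) b∈I))
  lift-normal normal γ-ideal {inj₂ a} {inj₂ b} p q = (λ ()) , (λ ())
  lift-normal normal γ-ideal {inj₁ a} {inj₁ b} {inj₁ c} {inj₂ d} () q
  lift-normal normal γ-ideal {inj₁ a} {inj₁ b} {inj₂ c} {inj₁ d} () q
  lift-normal normal γ-ideal {inj₁ a} {inj₂ b} {inj₁ c} {inj₁ d} p ()
  lift-normal normal γ-ideal {inj₁ a} {inj₂ b} {inj₁ c} {inj₂ d} () q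
  lift-normal normal γ-ideal {inj₁ a} {inj₂ b} {inj₂ c} {d} p ()
  lift-normal normal γ-ideal {inj₂ a} {inj₁ b} {inj₁ c} {inj₂ d} p ()
  lift-normal normal γ-ideal {inj₂ a} {inj₁ b} {inj₁ c} {inj₁ d} () q
  lift-normal normal γ-ideal {inj₂ a} {inj₁ b} {inj₂ c} {d} () q

  -- An ideal of P stays an ideal in U: nothing in P^η lies in it or below it.
  lift-ideal : ∀ {I : Carrier → Set} → IsIdeal I → UAlg.IsIdeal (lift I)
  lift-ideal {I} ((a , a∈I) , down , closed) =
    (inj₁ a , a∈I) , (λ {x} {y} → down-U {x} {y}) , (λ {x} {y} {z} → closed-U {x} {y} {z})
    where
    down-U : ∀ {x y} → UAlg._≤_ x y → lift I y → lift I x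
    down-U {inj₁ x} {inj₁ y} (inj₁ c , sxcy) y∈I = down (c , sxcy) y∈I
    down-U {inj₁ x} {inj₁ y} (inj₂ c , ())
    down-U {inj₂ x} {inj₁ y} (inj₁ c , ())
    down-U {inj₂ x} {inj₁ y} (inj₂ c , ())
    closed-U : ∀ {x y z} → SU x y z → lift I x → lift I y → lift I z
    closed-U {inj₁ x} {inj₁ y} {inj₁ z} sxyz x∈I y∈I = closed sxyz x∈I y∈I

  -- The mixed case of (R1) in U for i ≤ η a + b = η s, i.e. s ⊕ i defined and
  -- γ b ⊕ s = a: i ≤ j ⊕ k with j, k ∈ I, a ⊕ j defined and k ≤ b.
  r1-mixed-γ : ∀ {I : Carrier → Set} → IsNormal I → R1 I → R2i I → GCR I →
    ∀ {i s c a b} → I i → S s i c → S (γ b) s a →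
    Σ[ j ∈ Carrier ] Σ[ k ∈ Carrier ] I j × I k × Defined a j × k ≤ b ×
      (Σ[ t ∈ Carrier ] S j k t × i ≤ t)
  r1-mixed-γ normal r1 r2i gcr i∈I ssic sγbsa with proj₁ unitizing (_ , sγbsa)
  -- enlarge b to b ⊕ k₂ = ℓ ⊕ b above i with s ⊕ (ℓ ⊕ b) defined; split by (R1)
  ... | (_ , ssb) with enlarge-above normal gcr r2i i∈I ssic ssb
  ... | (_ , _ , k₂∈I , sbk₂bk , s⊕bk , i≤bk) with move-left normal sbk₂bk k₂∈I
  ... | (_ , sℓbbk , _) with r1 i∈I sℓbbk i≤bk
  -- ℓ = j ⊕ r, so (s ⊕ j) ⊕ (r ⊕ b) is defined, hence so are (s ⊕ j) ⊕ b,
  -- γ b ⊕ (s ⊕ j) by unitization, and (γ b ⊕ s) ⊕ j = a ⊕ j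
  ... | (j , k , j∈I , k∈I , (_ , sjrℓ) , k≤b , i≤j⊕k) with assoc₁ sjrℓ sℓbbk
  ... | (_ , srbrb , sj-rb-bk) with regroup sj-rb-bk s⊕bk
  ... | (_ , ssjsj , sj⊕rb) with regroup ssjsj (proj₂ unitizing (defined-right-part sj⊕rb srbrb))
  ... | (_ , sγbsa' , a'⊕j) with functional sγbsa' sγbsa
  ... | refl = j , k , j∈I , k∈I , a'⊕j , k≤b , i≤j⊕k

  module _ {I : Carrier → Set} (normal : IsNormal I) (γ-ideal : IsγIdeal I)
           (r1 : R1 I) (r2i : R2i I) (r2ii : R2ii I) (gcr : GCR I) where

    r1-lift : UAlg.R1 (lift I)
    r1-lift {inj₁ i} {inj₁ a} {inj₁ b} {inj₁ s} i∈I sabs (inj₁ c , sics) =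
      let (j , k , j∈I , k∈I , j≤a , k≤b , i≤j⊕k) = r1 i∈I sabs (c , sics)
      in inj₁ j , inj₁ k , j∈I , k∈I , ≤-P j≤a , ≤-P k≤b , below-sum-P i≤j⊕k
    -- i ≤ a + η b = η s: s ⊕ i defined and s ⊕ a = b
    r1-lift {inj₁ i} {inj₁ a} {inj₂ b} {inj₂ s} i∈I ssab (inj₂ c , ssic) =
      let (j , k , j∈I , k∈I , j≤a , b⊕k , i≤j⊕k) =
            r1-mixed normal gcr r1 r2i i∈I ssic ssab
      in inj₁ j , inj₁ k , j∈I , k∈I , ≤-P j≤a , ≤-η b⊕k , below-sum-P i≤j⊕k
    -- i ≤ η a + b = η s: s ⊕ i defined and γ b ⊕ s = a
    r1-lift {inj₁ i} {inj₂ a} {inj₁ b} {inj₂ s} i∈I sγbsa (inj₂ c , ssic) =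
      let (j , k , j∈I , k∈I , a⊕j , k≤b , i≤j⊕k) =
            r1-mixed-γ normal r1 r2i gcr {b = b} i∈I ssic sγbsa
      in inj₁ j , inj₁ k , j∈I , k∈I , ≤-η a⊕j , ≤-P k≤b , below-sum-P i≤j⊕k
    r1-lift {inj₁ i} {inj₁ a} {inj₁ b} {inj₁ s} i∈I _ (inj₂ c , ())
    r1-lift {inj₁ i} {inj₁ a} {inj₂ b} {inj₂ s} i∈I _ (inj₁ c , ())
    r1-lift {inj₁ i} {inj₂ a} {inj₁ b} {inj₂ s} i∈I _ (inj₁ c , ())
    r1-lift {inj₁ i} {inj₁ a} {inj₁ b} {inj₂ s} i∈I ()
    r1-lift {inj₁ i} {inj₁ a} {inj₂ b} {inj₁ s} i∈I ()
    r1-lift {inj₁ i} {inj₂ a} {inj₁ b} {inj₁ s} i∈I ()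
    r1-lift {inj₁ i} {inj₂ a} {inj₂ b} {s} i∈I ()
    r1-lift {inj₂ i} ()

    r2i-lift : UAlg.R2i (lift I)
    r2i-lift {inj₁ i} {inj₁ A} {inj₁ b} {inj₁ D} i∈I (inj₁ c₀ , siAc₀) sDiA (inj₁ x , sDbx) =
      let (j , j∈I , j≤b , (c , sjcb , (y , sAcy))) = r2i i∈I (c₀ , siAc₀) sDiA (x , sDbx)
      in inj₁ j , j∈I , ≤-P j≤b , inj₁ c , sjcb , (inj₁ y , sAcy)
    -- D + η b = η e: e ⊕ D = b
    r2i-lift {inj₁ i} {inj₁ A} {inj₂ b} {inj₁ D} i∈I _ sDiA (inj₂ e , seDb) =
      let (j , M , j∈I , sbjM , (x , sxAM)) = r2i-mixed normal gcr r2ii i∈I sDiA seDb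
      in inj₁ j , j∈I , ≤-η (M , sbjM) , inj₂ M , sbjM , (inj₂ x , sxAM)
    -- η d + i = η a and η d + b = η c: γ b ⊕ c = γ i ⊕ a, split γ b by (R1)
    r2i-lift {inj₁ i} {inj₂ a} {inj₁ b} {inj₂ d} i∈I _ sγiad (inj₂ c , sγbcd) =
      let (J , C , J∈I , sJCγb , (Y , sCYa)) =
            split-left-summand r1 (proj₁ (γ-ideal i) i∈I) sγiad sγbcd
      in inj₁ (γ⁻¹ J) , γ⁻¹-preserves γ-ideal J∈I , (inj₁ (γ⁻¹ C) , γ⁻¹-sum sJCγb) ,
         inj₁ (γ⁻¹ C) , γ⁻¹-sum sJCγb ,
         (inj₂ Y , subst (λ v → S v Y a) (sym (γ-inv₁ C)) sCYa)
    r2i-lift {inj₁ i} {inj₁ A} {inj₁ b} {inj₁ D} i∈I (inj₂ c₀ , ())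
    r2i-lift {inj₁ i} {inj₁ A} {inj₁ b} {inj₁ D} i∈I _ _ (inj₂ x , ())
    r2i-lift {inj₁ i} {inj₁ A} {inj₂ b} {inj₁ D} i∈I _ _ (inj₁ e , ())
    r2i-lift {inj₁ i} {inj₂ a} {inj₁ b} {inj₂ d} i∈I _ _ (inj₁ c , ())
    r2i-lift {inj₁ i} {inj₂ a} {inj₂ b} {inj₂ d} i∈I _ _ (c , ())
    r2i-lift {inj₁ i} {inj₁ A} {b} {inj₂ D} i∈I _ ()
    r2i-lift {inj₁ i} {inj₂ A} {b} {inj₁ D} i∈I _ ()
    r2i-lift {inj₂ i} ()

    r2ii-lift : UAlg.R2ii (lift I)
    r2ii-lift {inj₁ i} {inj₁ A} {inj₁ b} {inj₁ C} i∈I (inj₁ c₀ , siAc₀) siCA (inj₁ x , sbCx) =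
      let (k , k∈I , k≤b , (d , sdkb , (y , sdAy))) = r2ii i∈I (c₀ , siAc₀) siCA (x , sbCx)
      in inj₁ k , k∈I , ≤-P k≤b , inj₁ d , sdkb , (inj₁ y , sdAy)
    -- η b + C = η e: γ C ⊕ e = b; apply r2ii-mixed to γ i ⊕ γ C = γ A and
    -- take k = γ⁻¹ q, for which γ k ⊕ b is defined, hence so is b ⊕ k
    r2ii-lift {inj₁ i} {inj₁ A} {inj₂ b} {inj₁ C} i∈I _ siCA (inj₂ e , sγCeb) =
      let (q , N , q∈I , sqbN , (y , sγAyN)) =
            r2ii-mixed normal gcr r2i (proj₁ (γ-ideal i) i∈I) (proj₁ γ-hom siCA) sγCeb
          sγkbN = subst (λ v → S v b N) (sym (γ-inv₁ q)) sqbN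
      in inj₁ (γ⁻¹ q) , γ⁻¹-preserves γ-ideal q∈I ,
         ≤-η (proj₁ (unitizing {γ⁻¹ q} {b}) (N , sγkbN)) ,
         inj₂ N , sγkbN , (inj₂ y , sγAyN)
    -- i + η c = η a and b + η c = η e: e ⊕ b = a ⊕ i, split b by (R1)
    r2ii-lift {inj₁ i} {inj₂ a} {inj₁ b} {inj₂ c} i∈I _ saic (inj₂ e , sebc) =
      let (J , C , J∈I , sCJb , (z , szCa)) = split-right-summand normal r1 i∈I saic sebc
      in inj₁ J , J∈I , ≤-P (right-summand-≤ sCJb) , inj₁ C , sCJb , (inj₂ z , szCa)
    r2ii-lift {inj₁ i} {inj₁ A} {inj₁ b} {inj₁ C} i∈I (inj₂ c₀ , ())
    r2ii-lift {inj₁ i} {inj₁ A} {inj₁ b} {inj₁ C} i∈I _ _ (inj₂ x , ())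
    r2ii-lift {inj₁ i} {inj₁ A} {inj₂ b} {inj₁ C} i∈I _ _ (inj₁ e , ())
    r2ii-lift {inj₁ i} {inj₂ a} {inj₁ b} {inj₂ c} i∈I _ _ (inj₁ e , ())
    r2ii-lift {inj₁ i} {inj₂ a} {inj₂ b} {inj₂ c} i∈I _ _ (e , ())
    r2ii-lift {inj₁ i} {inj₁ A} {b} {inj₂ C} i∈I _ ()
    r2ii-lift {inj₁ i} {inj₂ A} {b} {inj₁ C} i∈I _ ()
    r2ii-lift {inj₂ i} ()

  -- (R2)(i) in U yields (GCR): for a = d ⊕ i, b = d ⊕ j apply it to i ≤ a and
  -- the sum d + η b = η e; it returns w ∈ I with b ⊕ w = x ⊕ a, and x ∈ I by
  -- left-summand-in-I.
  gcr-from-mixed-r2i : ∀ {I : Carrier → Set} → IsNormal I → IsIdeal I →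
    UAlg.R2i (lift I) → GCR I
  gcr-from-mixed-r2i normal ideal r2i-U (i , j , i∈I , j∈I , (c , sica) , _ , d , sdia , sdjb)
    with proj₁ (conj sdjb)
  ... | (e , sedb)
    with r2i-U {inj₁ i} {inj₁ _} {inj₂ _} {inj₁ d} i∈I (inj₁ c , sica) sdia (inj₂ e , sedb)
  ... | (inj₂ w , () , _)
  ... | (inj₁ w , _ , _ , (inj₁ N , () , _))
  ... | (inj₁ w , _ , _ , (inj₂ N , _ , (inj₁ x , ())))
  ... | (inj₁ w , w∈I , _ , (inj₂ N , sbwN , (inj₂ x , sxaN))) with move-left normal sbwN w∈I
  ... | (w' , sw'bN , w'∈I) =
    x , w' , left-summand-in-I normal ideal w'∈I j∈I sxaN sw'bN sdia sdjb , w'∈I , N , sxaN , sw'bN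

theorem4p20 : (P : GPEA) (u : UnitizingAut P) (I : GPEA.Carrier P → Set) →
    GPEA.IsNormal P I → GPEA.IsRieszIdeal P I → Unitization.IsγIdeal P u I →
    (Unitization.UAlg.IsNormalRieszIdeal P u (Unitization.lift P u I) ⟺ GPEA.GCR P I)
theorem4p20 P u I normal (ideal , r1 , r2i , r2ii) γ-ideal = to-gcr , from-gcr
  where
  open UnitizationFacts P u

  to-gcr : Unitization.UAlg.IsNormalRieszIdeal P u (Unitization.lift P u I) → GPEA.GCR P I
  to-gcr ((_ , _ , r2i-U , _) , _) =
    gcr-from-mixed-r2i normal ideal (λ {i a b d} → r2i-U {i} {a} {b} {d})

  from-gcr : GPEA.GCR P I → Unitization.UAlg.IsNormalRieszIdeal P u (Unitization.lift P u I)
  from-gcr gcr =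
    ( lift-ideal ideal
    , (λ {i a b s} → r1-lift normal γ-ideal r1 r2i r2ii gcr {i} {a} {b} {s})
    , (λ {i a b d} → r2i-lift normal γ-ideal r1 r2i r2ii gcr {i} {a} {b} {d})
    , (λ {i a b c} → r2ii-lift normal γ-ideal r1 r2i r2ii gcr {i} {a} {b} {c}) )
    , (λ {a b c d} → lift-normal normal γ-ideal {a} {b} {c} {d})
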